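{- Let $n\ge 1$. For $\pi,\sigma\in\mathbf{S}_n$ write $\pi\sim\sigma$ if there exists $k\in[1,n]$ with $\sigma=\pi+k$; this is an equivalence relation. The linking mapping $\Phi$ is well-defined on $\mathbf{S}_n/\!\sim$ (that is, $\Phi(\pi)=\Phi(\sigma)$ whenever $\pi\sim\sigma$), and the induced map $\mathbf{S}_n/\!\sim\;\to\mathbf{S}_n^c$ is a bijection.
   Context: $\mathbf{S}_n$ is the set of permutations of $[1,n]$, written $\pi=\pi(1)\pi(2)\dots\pi(n)$; composition is $(\pi\sigma)(i)=\pi(\sigma(i))$. Addition of a constant to permutation values is cyclic: $\pi(i)+k=((\pi(i)-1+k)\bmod n)+1$ (so $n+1\equiv 1$, $1-1\equiv n$), and $\pi+k$ denotes the permutation $i\mapsto \pi(i)+k$. $\mathbf{S}_n^c$ is the set of permutations in $\mathbf{S}_n$ consisting of exactly one cycle (one orbit). The linking permutation of $\pi\in\mathbf{S}_n$ is $\Phi(\pi)=\pi^{ -1}(\pi+1)$, i.e. $\Phi(\pi)(i)=\pi^{ -1}(\pi(i)+1)$; it lies in $\mathbf{S}_n^c$. -}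

module Defs where

open import Data.Nat using (ℕ; zero; suc; _+_; _≤_; NonZero)
open import Data.Nat.DivMod using (_mod_)
open import Data.Fin using (Fin; toℕ)
open import Data.Fin.Permutation using (Permutation′; _⟨$⟩ʳ_; _⟨$⟩ˡ_)
open import Data.Product using (Σ; ∃; _×_; _,_)
open import Function.Definitions using (Bijective)
open import Relation.Binary.PropositionalEquality using (_≡_)

-- Convention: [1,n] is represented by Fin n = {0,…,n-1} (value v ↔ v+1).
-- Cyclic addition of a constant k to a value: x + k taken mod n.
-- (Under the shift v ↦ v+1 this is exactly ((x-1+k) mod n)+1.)
_+ᶜ_ : ∀ {n} .{{_ : NonZero n}} → Fin n → ℕ → Fin n
_+ᶜ_ {n} x k = (toℕ x + k) mod n

_∼_ : ∀ {n} .{{_ : NonZero n}} → Permutation′ n → Permutation′ n → Set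
_∼_ {n} π σ = Σ ℕ λ k → (1 ≤ k) × (k ≤ n) × (∀ i → σ ⟨$⟩ʳ i ≡ (π ⟨$⟩ʳ i) +ᶜ k)

Φ : ∀ {n} .{{_ : NonZero n}} → Permutation′ n → Fin n → Fin n
Φ π i = π ⟨$⟩ˡ ((π ⟨$⟩ʳ i) +ᶜ 1)

iter : ∀ {A : Set} → (A → A) → ℕ → A → A
iter f zero x = x
iter f (suc t) x = f (iter f t x)

OneOrbit : ∀ {n} → (Fin n → Fin n) → Set
OneOrbit {n} f = ∀ (i j : Fin n) → ∃ λ t → iter f t i ≡ j

InSnc : ∀ {n} → (Fin n → Fin n) → Set
InSnc f = Bijective _≡_ _≡_ f × OneOrbit f

module Submission where

-- Φ(π) = π⁻¹ ∘ (+1) ∘ π is conjugate to the n-cycle x ↦ x + 1, so it is an n-cycle whose t-th iterate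
-- is π⁻¹ ∘ (+t) ∘ π; as +k commutes with +1, Φ is constant on shift classes. Conversely, if Φ π = Φ σ,
-- then σ ∘ π⁻¹ commutes with +1 and is therefore the shift by its value at a single point. A one-cycle
-- τ is the linking permutation of the π whose inverse enumerates an orbit, t ↦ τᵗ(x): this enumeration
-- is a bijection because x returns to itself within n steps (pigeonhole) and not earlier (the first
-- p iterates of a p-periodic point cover the whole orbit, so p ≥ n).

open import Defs
open import Data.Nat using (ℕ; zero; suc; pred; _+_; _*_; _∸_; _≤_; _<_; z≤n; s≤s; s≤s⁻¹; _%_; _/_; NonZero; >-nonZero; >-nonZero⁻¹)
open import Data.Nat.Properties
open import Data.Nat.DivMod
open import Data.Fin as Fin using (Fin; toℕ)
open import Data.Fin.Properties using (toℕ-fromℕ<; toℕ-injective; toℕ<n; pigeonhole; injective⇒≤)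
open import Data.Fin.Permutation using (Permutation′; _⟨$⟩ʳ_; _⟨$⟩ˡ_; inverseˡ; inverseʳ; flip)
open import Data.Product using (∃; _×_; _,_; proj₁; proj₂)
open import Function.Definitions using (Injective; Surjective; Bijective)
open import Function.Bundles using (mk⤖; Injection)
open import Function.Properties.Bijection using (⤖⇒↔)
open import Function.Properties.Inverse using (↔⇒↣)
open import Relation.Binary.Structures using (IsEquivalence)
open import Relation.Binary.Definitions using (Reflexive; Symmetric; Transitive; tri<; tri≈; tri>)
open import Relation.Binary.PropositionalEquality
open import Relation.Nullary using (contradiction)

module _ {A : Set} (f : A → A) where

  iter-+ : ∀ a b x → iter f (a + b) x ≡ iter f a (iter f b x)
  iter-+ zero    b x = refl
  iter-+ (suc a) b x = cong f (iter-+ a b x)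

  iter-injective : Injective _≡_ _≡_ f → ∀ t {x y} → iter f t x ≡ iter f t y → x ≡ y
  iter-injective f-inj zero    eq = eq
  iter-injective f-inj (suc t) eq = iter-injective f-inj t (f-inj eq)

  iter-return : Injective _≡_ _≡_ f → ∀ {a b x} → a ≤ b → iter f a x ≡ iter f b x → iter f (b ∸ a) x ≡ x
  iter-return f-inj {a} {b} {x} a≤b eq = iter-injective f-inj a (begin
    iter f a (iter f (b ∸ a) x)  ≡⟨ iter-+ a (b ∸ a) x ⟨
    iter f (a + (b ∸ a)) x       ≡⟨ cong (λ t → iter f t x) (m+[n∸m]≡n a≤b) ⟩
    iter f b x                   ≡⟨ eq ⟨
    iter f a x                   ∎)
    where open ≡-Reasoning

  module _ {x : A} (p : ℕ) .{{_ : NonZero p}} (return : iter f p x ≡ x) where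

    iter-multiple : ∀ k → iter f (k * p) x ≡ x
    iter-multiple zero    = refl
    iter-multiple (suc k) = trans (iter-+ p (k * p) x) (trans (cong (iter f p) (iter-multiple k)) return)

    iter-% : ∀ t → iter f t x ≡ iter f (t % p) x
    iter-% t = begin
      iter f t x                               ≡⟨ cong (λ s → iter f s x) (m≡m%n+[m/n]*n t p) ⟩
      iter f (t % p + (t / p) * p) x           ≡⟨ iter-+ (t % p) ((t / p) * p) x ⟩
      iter f (t % p) (iter f ((t / p) * p) x)  ≡⟨ cong (iter f (t % p)) (iter-multiple (t / p)) ⟩
      iter f (t % p) x                         ∎
      where open ≡-Reasoning

  iter-periodic⇒bijective : ∀ p .{{_ : NonZero p}} → (∀ x → iter f p x ≡ x) → Bijective _≡_ _≡_ f
  iter-periodic⇒bijective p periodic = f-injective , λ y → iter f (pred p) y , λ { refl → f∘g≗id y }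
    where
    f∘g≗id : ∀ y → f (iter f (pred p) y) ≡ y
    f∘g≗id y = trans (cong (λ t → iter f t y) (suc-pred p)) (periodic y)
    g∘f≗id : ∀ y → iter f (pred p) (f y) ≡ y
    g∘f≗id y = begin
      iter f (pred p) (iter f 1 y)  ≡⟨ iter-+ (pred p) 1 y ⟨
      iter f (pred p + 1) y         ≡⟨ cong (λ t → iter f t y) (trans (+-comm (pred p) 1) (suc-pred p)) ⟩
      iter f p y                    ≡⟨ periodic y ⟩
      y                             ∎
      where open ≡-Reasoning
    f-injective : Injective _≡_ _≡_ f
    f-injective {a} {b} eq = trans (sym (g∘f≗id a)) (trans (cong (iter f (pred p)) eq) (g∘f≗id b))

iter-cong : ∀ {A : Set} {f g : A → A} → (∀ x → f x ≡ g x) → ∀ t x → iter f t x ≡ iter g t x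
iter-cong f≗g zero    x = refl
iter-cong {f = f} f≗g (suc t) x = trans (cong f (iter-cong f≗g t x)) (f≗g _)

module _ {n : ℕ} .{{_ : NonZero n}} where

  toℕ-+ᶜ : (x : Fin n) (k : ℕ) → toℕ (x +ᶜ k) ≡ (toℕ x + k) % n
  toℕ-+ᶜ x k = toℕ-fromℕ< (m%n<n (toℕ x + k) n)

  toℕ-%-identity : (x : Fin n) → toℕ x % n ≡ toℕ x
  toℕ-%-identity x = m<n⇒m%n≡m (toℕ<n x)

  +ᶜ-≡ : (x y : Fin n) (a b : ℕ) → (toℕ x + a) % n ≡ (toℕ y + b) % n → x +ᶜ a ≡ y +ᶜ b
  +ᶜ-≡ x y a b eq = toℕ-injective (trans (toℕ-+ᶜ x a) (trans eq (sym (toℕ-+ᶜ y b))))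

  +ᶜ-identityʳ : (x : Fin n) → x +ᶜ 0 ≡ x
  +ᶜ-identityʳ x = toℕ-injective (begin
    toℕ (x +ᶜ 0)     ≡⟨ toℕ-+ᶜ x 0 ⟩
    (toℕ x + 0) % n  ≡⟨ cong (_% n) (+-identityʳ (toℕ x)) ⟩
    toℕ x % n        ≡⟨ toℕ-%-identity x ⟩
    toℕ x            ∎)
    where open ≡-Reasoning

  +ᶜ-+ : (x : Fin n) (a b : ℕ) → (x +ᶜ a) +ᶜ b ≡ x +ᶜ (a + b)
  +ᶜ-+ x a b = +ᶜ-≡ (x +ᶜ a) x b (a + b) (begin
    (toℕ (x +ᶜ a) + b) % n             ≡⟨ cong (λ y → (y + b) % n) (toℕ-+ᶜ x a) ⟩
    ((toℕ x + a) % n + b) % n          ≡⟨ %-distribˡ-+ ((toℕ x + a) % n) b n ⟩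
    ((toℕ x + a) % n % n + b % n) % n  ≡⟨ cong (λ y → (y + b % n) % n) (m%n%n≡m%n (toℕ x + a) n) ⟩
    ((toℕ x + a) % n + b % n) % n      ≡⟨ %-distribˡ-+ (toℕ x + a) b n ⟨
    (toℕ x + a + b) % n                ≡⟨ cong (_% n) (+-assoc (toℕ x) a b) ⟩
    (toℕ x + (a + b)) % n              ∎)
    where open ≡-Reasoning

  +ᶜ-+ᶜ-swap : (x : Fin n) (a b : ℕ) → (x +ᶜ a) +ᶜ b ≡ (x +ᶜ b) +ᶜ a
  +ᶜ-+ᶜ-swap x a b = begin
    (x +ᶜ a) +ᶜ b  ≡⟨ +ᶜ-+ x a b ⟩
    x +ᶜ (a + b)   ≡⟨ cong (x +ᶜ_) (+-comm a b) ⟩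
    x +ᶜ (b + a)   ≡⟨ +ᶜ-+ x b a ⟨
    (x +ᶜ b) +ᶜ a  ∎
    where open ≡-Reasoning

  +ᶜ-% : (x : Fin n) (k : ℕ) → x +ᶜ (k % n) ≡ x +ᶜ k
  +ᶜ-% x k = +ᶜ-≡ x x (k % n) k (begin
    (toℕ x + k % n) % n        ≡⟨ cong (λ y → (y + k % n) % n) (toℕ-%-identity x) ⟨
    (toℕ x % n + k % n) % n    ≡⟨ %-distribˡ-+ (toℕ x) k n ⟨
    (toℕ x + k) % n            ∎)
    where open ≡-Reasoning

  +ᶜ-size : (x : Fin n) → x +ᶜ n ≡ x
  +ᶜ-size x = toℕ-injective (trans (toℕ-+ᶜ x n) (trans ([m+n]%n≡m%n (toℕ x) n) (toℕ-%-identity x)))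

  +ᶜ-reach : (x y : Fin n) → x +ᶜ (n ∸ toℕ x + toℕ y) ≡ y
  +ᶜ-reach x y = toℕ-injective (begin
    toℕ (x +ᶜ (n ∸ toℕ x + toℕ y))       ≡⟨ toℕ-+ᶜ x _ ⟩
    (toℕ x + (n ∸ toℕ x + toℕ y)) % n    ≡⟨ cong (_% n) (+-assoc (toℕ x) _ _) ⟨
    (toℕ x + (n ∸ toℕ x) + toℕ y) % n    ≡⟨ cong (λ m → (m + toℕ y) % n) (m+[n∸m]≡n (<⇒≤ (toℕ<n x))) ⟩
    (n + toℕ y) % n                      ≡⟨ cong (_% n) (+-comm n (toℕ y)) ⟩
    (toℕ y + n) % n                      ≡⟨ [m+n]%n≡m%n (toℕ y) n ⟩
    toℕ y % n                            ≡⟨ toℕ-%-identity y ⟩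
    toℕ y                                ∎)
    where open ≡-Reasoning

  shift⇒∼ : (π σ : Permutation′ n) (d : ℕ) → (∀ i → σ ⟨$⟩ʳ i ≡ (π ⟨$⟩ʳ i) +ᶜ d) → π ∼ σ
  shift⇒∼ π σ d σ≡π+d =
    suc ((d + pred n) % n) , s≤s z≤n , m%n<n (d + pred n) n ,
    λ i → trans (σ≡π+d i) (sym (+ᶜ-normalised (π ⟨$⟩ʳ i)))
    where
    +ᶜ-normalised : (x : Fin n) → x +ᶜ suc ((d + pred n) % n) ≡ x +ᶜ d
    +ᶜ-normalised x = begin
      x +ᶜ (1 + (d + pred n) % n)     ≡⟨ +ᶜ-+ x 1 _ ⟨
      (x +ᶜ 1) +ᶜ ((d + pred n) % n)  ≡⟨ +ᶜ-% (x +ᶜ 1) (d + pred n) ⟩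
      (x +ᶜ 1) +ᶜ (d + pred n)        ≡⟨ +ᶜ-+ x 1 (d + pred n) ⟩
      x +ᶜ suc (d + pred n)           ≡⟨ cong (x +ᶜ_) (trans (sym (+-suc d (pred n))) (cong (d +_) (suc-pred n))) ⟩
      x +ᶜ (d + n)                    ≡⟨ +ᶜ-+ x d n ⟨
      (x +ᶜ d) +ᶜ n                   ≡⟨ +ᶜ-size (x +ᶜ d) ⟩
      x +ᶜ d                          ∎
      where open ≡-Reasoning

  ∼-refl : Reflexive (_∼_ {n})
  ∼-refl {π} = n , >-nonZero⁻¹ n , ≤-refl , λ i → sym (+ᶜ-size (π ⟨$⟩ʳ i))

  ∼-sym : Symmetric (_∼_ {n})
  ∼-sym {π} {σ} (k , _ , k≤n , σ≡π+k) = shift⇒∼ σ π (n ∸ k) λ i → begin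
    π ⟨$⟩ʳ i                      ≡⟨ +ᶜ-size _ ⟨
    (π ⟨$⟩ʳ i) +ᶜ n               ≡⟨ cong ((π ⟨$⟩ʳ i) +ᶜ_) (m+[n∸m]≡n k≤n) ⟨
    (π ⟨$⟩ʳ i) +ᶜ (k + (n ∸ k))   ≡⟨ +ᶜ-+ _ k (n ∸ k) ⟨
    ((π ⟨$⟩ʳ i) +ᶜ k) +ᶜ (n ∸ k)  ≡⟨ cong (_+ᶜ (n ∸ k)) (σ≡π+k i) ⟨
    (σ ⟨$⟩ʳ i) +ᶜ (n ∸ k)         ∎
    where open ≡-Reasoning

  ∼-trans : Transitive (_∼_ {n})
  ∼-trans {π} {_} {ρ} (k , _ , _ , σ≡π+k) (l , _ , _ , ρ≡σ+l) = shift⇒∼ π ρ (k + l) λ i →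
    trans (ρ≡σ+l i) (trans (cong (_+ᶜ l) (σ≡π+k i)) (+ᶜ-+ (π ⟨$⟩ʳ i) k l))

  -- The permutations must be passed explicitly: _∼_ unfolds to a Σ-type from which they cannot be inferred.
  ∼-isEquivalence : IsEquivalence (_∼_ {n})
  ∼-isEquivalence = record
    { refl  = λ {π} → ∼-refl {π}
    ; sym   = λ {π} {σ} → ∼-sym {π} {σ}
    ; trans = λ {π} {σ} {ρ} → ∼-trans {π} {σ} {ρ}
    }

  ⟨$⟩ʳ-injective : (π : Permutation′ n) → Injective _≡_ _≡_ (π ⟨$⟩ʳ_)
  ⟨$⟩ʳ-injective π = Injection.injective (↔⇒↣ π)

  Φ-iter : (π : Permutation′ n) (t : ℕ) (i : Fin n) → π ⟨$⟩ʳ iter (Φ π) t i ≡ (π ⟨$⟩ʳ i) +ᶜ t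
  Φ-iter π zero    i = sym (+ᶜ-identityʳ _)
  Φ-iter π (suc t) i = begin
    π ⟨$⟩ʳ Φ π (iter (Φ π) t i)   ≡⟨ inverseʳ π ⟩
    (π ⟨$⟩ʳ iter (Φ π) t i) +ᶜ 1  ≡⟨ cong (_+ᶜ 1) (Φ-iter π t i) ⟩
    ((π ⟨$⟩ʳ i) +ᶜ t) +ᶜ 1        ≡⟨ +ᶜ-+ _ t 1 ⟩
    (π ⟨$⟩ʳ i) +ᶜ (t + 1)         ≡⟨ cong ((π ⟨$⟩ʳ i) +ᶜ_) (+-comm t 1) ⟩
    (π ⟨$⟩ʳ i) +ᶜ suc t           ∎
    where open ≡-Reasoning

  Φ-iter-reach : (π : Permutation′ n) (i j : Fin n) →
                 iter (Φ π) (n ∸ toℕ (π ⟨$⟩ʳ i) + toℕ (π ⟨$⟩ʳ j)) i ≡ j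
  Φ-iter-reach π i j = ⟨$⟩ʳ-injective π (trans (Φ-iter π _ i) (+ᶜ-reach (π ⟨$⟩ʳ i) (π ⟨$⟩ʳ j)))

  Φ-oneOrbit : (π : Permutation′ n) → OneOrbit (Φ π)
  Φ-oneOrbit π i j = n ∸ toℕ (π ⟨$⟩ʳ i) + toℕ (π ⟨$⟩ʳ j) , Φ-iter-reach π i j

  Φ-bijective : (π : Permutation′ n) → Bijective _≡_ _≡_ (Φ π)
  Φ-bijective π = iter-periodic⇒bijective (Φ π) n λ i →
    ⟨$⟩ʳ-injective π (trans (Φ-iter π n i) (+ᶜ-size _))

  ∼⇒Φ≗ : (π σ : Permutation′ n) → π ∼ σ → ∀ i → Φ π i ≡ Φ σ i
  ∼⇒Φ≗ π σ (k , _ , _ , σ≡π+k) i = ⟨$⟩ʳ-injective σ (begin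
    σ ⟨$⟩ʳ Φ π i            ≡⟨ σ≡π+k (Φ π i) ⟩
    (π ⟨$⟩ʳ Φ π i) +ᶜ k     ≡⟨ cong (_+ᶜ k) (inverseʳ π) ⟩
    ((π ⟨$⟩ʳ i) +ᶜ 1) +ᶜ k  ≡⟨ +ᶜ-+ᶜ-swap _ 1 k ⟩
    ((π ⟨$⟩ʳ i) +ᶜ k) +ᶜ 1  ≡⟨ cong (_+ᶜ 1) (σ≡π+k i) ⟨
    (σ ⟨$⟩ʳ i) +ᶜ 1         ≡⟨ inverseʳ σ ⟨
    σ ⟨$⟩ʳ Φ σ i            ∎)
    where open ≡-Reasoning

  Φ≗⇒∼ : (c : Fin n) (π σ : Permutation′ n) → (∀ i → Φ π i ≡ Φ σ i) → π ∼ σ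
  Φ≗⇒∼ c π σ Φπ≗Φσ = shift⇒∼ π σ d λ j → let t = n ∸ toℕ (π ⟨$⟩ʳ c) + toℕ (π ⟨$⟩ʳ j) in begin
    σ ⟨$⟩ʳ j                      ≡⟨ cong (σ ⟨$⟩ʳ_) (Φ-iter-reach π c j) ⟨
    σ ⟨$⟩ʳ iter (Φ π) t c         ≡⟨ cong (σ ⟨$⟩ʳ_) (iter-cong Φπ≗Φσ t c) ⟩
    σ ⟨$⟩ʳ iter (Φ σ) t c         ≡⟨ Φ-iter σ t c ⟩
    (σ ⟨$⟩ʳ c) +ᶜ t               ≡⟨ cong (_+ᶜ t) (+ᶜ-reach (π ⟨$⟩ʳ c) (σ ⟨$⟩ʳ c)) ⟨
    ((π ⟨$⟩ʳ c) +ᶜ d) +ᶜ t        ≡⟨ +ᶜ-+ᶜ-swap (π ⟨$⟩ʳ c) d t ⟩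
    ((π ⟨$⟩ʳ c) +ᶜ t) +ᶜ d        ≡⟨ cong (_+ᶜ d) (Φ-iter π t c) ⟨
    (π ⟨$⟩ʳ iter (Φ π) t c) +ᶜ d  ≡⟨ cong (λ y → (π ⟨$⟩ʳ y) +ᶜ d) (Φ-iter-reach π c j) ⟩
    (π ⟨$⟩ʳ j) +ᶜ d               ∎
    where
    open ≡-Reasoning
    d : ℕ
    d = n ∸ toℕ (π ⟨$⟩ʳ c) + toℕ (σ ⟨$⟩ʳ c)

module _ {n : ℕ} {f : Fin n → Fin n} where

  oneOrbit⇒covered-before-return : OneOrbit f → ∀ {x} p .{{_ : NonZero p}} → iter f p x ≡ x →
                                    ∀ y → ∃ λ (r : Fin p) → iter f (toℕ r) x ≡ y
  oneOrbit⇒covered-before-return orbit {x} p return y = t mod p , (begin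
    iter f (toℕ (t mod p)) x  ≡⟨ cong (λ s → iter f s x) (toℕ-fromℕ< (m%n<n t p)) ⟩
    iter f (t % p) x          ≡⟨ iter-% f p return t ⟨
    iter f t x                ≡⟨ proj₂ (orbit x y) ⟩
    y                         ∎)
    where
    open ≡-Reasoning
    t : ℕ
    t = proj₁ (orbit x y)

  oneOrbit⇒size≤return : OneOrbit f → ∀ {x} p .{{_ : NonZero p}} → iter f p x ≡ x → n ≤ p
  oneOrbit⇒size≤return orbit {x} p return = injective⇒≤ residue-injective
    where
    residue : Fin n → Fin p
    residue y = proj₁ (oneOrbit⇒covered-before-return orbit p return y)
    residue-injective : Injective _≡_ _≡_ residue
    residue-injective {y} {z} eq = begin
      y                            ≡⟨ proj₂ (oneOrbit⇒covered-before-return orbit p return y) ⟨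
      iter f (toℕ (residue y)) x   ≡⟨ cong (λ r → iter f (toℕ r) x) eq ⟩
      iter f (toℕ (residue z)) x   ≡⟨ proj₂ (oneOrbit⇒covered-before-return orbit p return z) ⟩
      z                            ∎
      where open ≡-Reasoning

  injective⇒return≤size : Injective _≡_ _≡_ f → ∀ x → ∃ λ p → 0 < p × p ≤ n × iter f p x ≡ x
  injective⇒return≤size f-inj x with pigeonhole (n<1+n n) (λ i → iter f (toℕ i) x)
  ... | i , j , i<j , eq =
    toℕ j ∸ toℕ i , m<n⇒0<n∸m i<j , ≤-trans (m∸n≤m (toℕ j) (toℕ i)) (s≤s⁻¹ (toℕ<n j)) ,
    iter-return f f-inj (<⇒≤ i<j) eq

  module _ (f-inj : Injective _≡_ _≡_ f) (orbit : OneOrbit f) where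

    oneOrbit⇒iter-size : ∀ x → iter f n x ≡ x
    oneOrbit⇒iter-size x with injective⇒return≤size f-inj x
    ... | p , 0<p , p≤n , return =
      subst (λ q → iter f q x ≡ x) (≤-antisym p≤n (oneOrbit⇒size≤return orbit p {{>-nonZero 0<p}} return)) return

    oneOrbit⇒no-early-return : ∀ {x c d} → c < d → d < n → iter f c x ≢ iter f d x
    oneOrbit⇒no-early-return {x} {c} {d} c<d d<n eq = <⇒≱ (≤-<-trans (m∸n≤m d c) d<n)
      (oneOrbit⇒size≤return orbit (d ∸ c) {{>-nonZero (m<n⇒0<n∸m c<d)}} (iter-return f f-inj (<⇒≤ c<d) eq))

    oneOrbit⇒iter-injective : ∀ {x a b} → a < n → b < n → iter f a x ≡ iter f b x → a ≡ b
    oneOrbit⇒iter-injective {x} {a} {b} a<n b<n eq with <-cmp a b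
    ... | tri< a<b _ _ = contradiction eq (oneOrbit⇒no-early-return a<b b<n)
    ... | tri≈ _ a≡b _ = a≡b
    ... | tri> _ _ b<a = contradiction (sym eq) (oneOrbit⇒no-early-return b<a a<n)

module _ {n : ℕ} .{{_ : NonZero n}} {f : Fin n → Fin n}
         (f-inj : Injective _≡_ _≡_ f) (orbit : OneOrbit f) (x : Fin n) where

  enumerate : Fin n → Fin n
  enumerate t = iter f (toℕ t) x

  enumerate-+ᶜ : ∀ t k → enumerate (t +ᶜ k) ≡ iter f k (enumerate t)
  enumerate-+ᶜ t k = begin
    iter f (toℕ (t +ᶜ k)) x       ≡⟨ cong (λ s → iter f s x) (toℕ-+ᶜ t k) ⟩
    iter f ((toℕ t + k) % n) x    ≡⟨ iter-% f n (oneOrbit⇒iter-size f-inj orbit x) (toℕ t + k) ⟨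
    iter f (toℕ t + k) x          ≡⟨ cong (λ s → iter f s x) (+-comm (toℕ t) k) ⟩
    iter f (k + toℕ t) x          ≡⟨ iter-+ f k (toℕ t) x ⟩
    iter f k (iter f (toℕ t) x)   ∎
    where open ≡-Reasoning

  enumerate-bijective : Bijective _≡_ _≡_ enumerate
  enumerate-bijective = enumerate-injective , enumerate-surjective
    where
    enumerate-injective : Injective _≡_ _≡_ enumerate
    enumerate-injective {a} {b} eq = toℕ-injective (oneOrbit⇒iter-injective f-inj orbit (toℕ<n a) (toℕ<n b) eq)
    enumerate-surjective : Surjective _≡_ _≡_ enumerate
    enumerate-surjective y with oneOrbit⇒covered-before-return orbit n (oneOrbit⇒iter-size f-inj orbit x) y
    ... | r , eq = r , λ { refl → eq }

  enumeration-permutation : Permutation′ n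
  enumeration-permutation = flip (⤖⇒↔ (mk⤖ enumerate-bijective))

oneOrbit⇒Φ-preimage : ∀ {n} .{{_ : NonZero n}} (τ : Permutation′ n) → Fin n → OneOrbit (τ ⟨$⟩ʳ_) →
                      ∃ λ (π : Permutation′ n) → ∀ i → Φ π i ≡ τ ⟨$⟩ʳ i
oneOrbit⇒Φ-preimage τ x orbit = π , λ i → begin
  enumerate τ-inj orbit x ((π ⟨$⟩ʳ i) +ᶜ 1)  ≡⟨ enumerate-+ᶜ τ-inj orbit x (π ⟨$⟩ʳ i) 1 ⟩
  τ ⟨$⟩ʳ (π ⟨$⟩ˡ (π ⟨$⟩ʳ i))                 ≡⟨ cong (τ ⟨$⟩ʳ_) (inverseˡ π) ⟩
  τ ⟨$⟩ʳ i                                   ∎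
  where
  open ≡-Reasoning
  τ-inj : Injective _≡_ _≡_ (τ ⟨$⟩ʳ_)
  τ-inj = ⟨$⟩ʳ-injective τ
  π : Permutation′ _
  π = enumeration-permutation τ-inj orbit x

mainTheorem1 : (m : ℕ) →
    IsEquivalence (_∼_ {suc m})
    × (∀ (π σ : Permutation′ (suc m)) → π ∼ σ → ∀ i → Φ π i ≡ Φ σ i)
    × (∀ (π : Permutation′ (suc m)) → InSnc (Φ π))
    × (∀ (π σ : Permutation′ (suc m)) → (∀ i → Φ π i ≡ Φ σ i) → π ∼ σ)
    × (∀ (τ : Permutation′ (suc m)) → OneOrbit (τ ⟨$⟩ʳ_) →
         ∃ λ (π : Permutation′ (suc m)) → ∀ i → Φ π i ≡ τ ⟨$⟩ʳ i)
mainTheorem1 m =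
  ∼-isEquivalence ,
  ∼⇒Φ≗ ,
  (λ π → Φ-bijective π , Φ-oneOrbit π) ,
  Φ≗⇒∼ Fin.zero ,
  (λ τ → oneOrbit⇒Φ-preimage τ Fin.zero)
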